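{- Let $r\geq 2$ be a fixed integer. There is a positive constant $\eta_1=\eta_1(r)$ such that the following holds. Let $k=k(n)$ satisfy $2\leq k\leq C n^{1/7}$ for a fixed constant $C>0$ (or $k=o(n^{1/3})$ when $r\in\{2,3\}$) and $n\geq r(k+\tfrac12)$. Then for all sufficiently large $n$, every $\mathcal{A}\in\mathcal{C}_1$ satisfies $$|E(\operatorname{KG}^r_{n,k}[\mathcal{A}])|\geq \eta_1 N^r .$$
   Context: $[n]=\{1,\dots,n\}$, $\binom{[n]}{k}$ is the family of $k$-subsets of $[n]$. $\operatorname{KG}^r_{n,k}$ is the $r$-uniform hypergraph on $\binom{[n]}{k}$ whose edges are the $r$-sets of pairwise disjoint $k$-sets; $\operatorname{KG}^r_{n,k}[\mathcal{A}]$ is its subhypergraph induced on $\mathcal{A}$. For $x\in[n]$, the star is $\mathcal{S}_x=\{A\in\binom{[n]}{k}:x\in A\}$. Let $N=\binom{n}{k}-\binom{n-r+1}{k}$. Let $\mathcal{C}$ be the set of families $\mathcal{A}\subseteq\binom{[n]}{k}$ with $|\mathcal{A}|=N$ that are not the union of any $r-1$ stars. For $\mathcal{A}\in\mathcal{C}$ and $x\in[n]$ put $\mathcal{A}_x=\mathcal{A}\cap\mathcal{S}_x$, and fix an ordering $x_1,\dots,x_n$ of $[n]$ (ties broken arbitrarily) such that $|\mathcal{A}_{x_1}|\geq|\mathcal{A}_{x_2}|\geq\cdots\geq|\mathcal{A}_{x_n}|$. Define $\mathcal{C}_1=\{\mathcal{A}\in\mathcal{C}: |\mathcal{A}_{x_{r-1}}|<\frac{N}{2r^2k}\}$.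 -}

module Defs where

open import Data.Bool using (Bool; true; false; _∧_; _∨_; not; if_then_else_)
open import Data.Nat using (ℕ; zero; suc; _+_; _*_; _∸_; _^_; _≤_; _<_; _≡ᵇ_)
open import Data.Nat.Properties using (≤-decTotalOrder)
open import Data.Nat.Combinatorics using (_C_)
open import Data.Fin using (Fin)
open import Data.Fin.Subset using (Subset; ∣_∣)
open import Data.Vec using (Vec; []; _∷_; lookup; zipWith; foldr)
open import Data.List using (List; []; _∷_; map; length; filter; reverse; concatMap; _++_; allFin)
open import Data.List.Sort ≤-decTotalOrder using (sort)
open import Relation.Binary.PropositionalEquality using (_≡_)
open import Relation.Nullary.Decidable using (does)
open import Data.Bool.Properties using (_≟_)

allSubsets : ∀ n → List (Subset n)
allSubsets zero = [] ∷ []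
allSubsets (suc n) = map (true ∷_) (allSubsets n) ++ map (false ∷_) (allSubsets n)

Family : ℕ → Set
Family n = Subset n → Bool

hasSize : ∀ {n} → ℕ → Subset n → Bool
hasSize k A = ∣ A ∣ ≡ᵇ k

IsKFamily : ∀ {n} → ℕ → Family n → Set
IsKFamily k 𝒜 = ∀ A → 𝒜 A ≡ true → ∣ A ∣ ≡ k

members : ∀ {n} → Family n → List (Subset n)
members {n} 𝒜 = filter (λ A → 𝒜 A ≟ true) (allSubsets n)

card : ∀ {n} → Family n → ℕ
card 𝒜 = length (members 𝒜)

disjoint : ∀ {n} → Subset n → Subset n → Bool
disjoint A B = foldr (λ _ → Bool) _∧_ true (zipWith (λ a b → not (a ∧ b)) A B)

meets : ∀ {n} → Subset n → Subset n → Bool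
meets A B = not (disjoint A B)

combinations : ∀ {a} {X : Set a} → ℕ → List X → List (List X)
combinations zero xs = [] ∷ []
combinations (suc r) [] = []
combinations (suc r) (x ∷ xs) = map (x ∷_) (combinations r xs) ++ combinations (suc r) xs

pairwiseDisjoint : ∀ {n} → List (Subset n) → Bool
pairwiseDisjoint [] = true
pairwiseDisjoint (A ∷ As) = allB As ∧ pairwiseDisjoint As
  where
  allB : List _ → Bool
  allB [] = true
  allB (B ∷ Bs) = disjoint A B ∧ allB Bs

-- |E(KG^r_{n,k}[𝒜])| : number of r-sets of pairwise disjoint members of 𝒜.
-- (members 𝒜 has no repetitions, so r-combinations are exactly the r-subsets of 𝒜.)
numEdges : ∀ {n} → ℕ → Family n → ℕ
numEdges r 𝒜 = length (filter (λ e → pairwiseDisjoint e ≟ true) (combinations r (members 𝒜)))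

degree : ∀ {n} → Family n → Fin n → ℕ
degree 𝒜 x = length (filter (λ A → lookup A x ≟ true) (members 𝒜))

-- i-th element (0-indexed) of a list, 0 if out of range.
nth : List ℕ → ℕ → ℕ
nth [] _ = 0
nth (x ∷ xs) zero = x
nth (x ∷ xs) (suc i) = nth xs i

sortedDegrees : ∀ {n} → Family n → List ℕ
sortedDegrees {n} 𝒜 = reverse (sort (map (degree 𝒜) (allFin n)))

-- |𝒜_{x_i}| for i ≥ 1 (1-indexed as in the paper).
degreeAt : ∀ {n} → Family n → ℕ → ℕ
degreeAt 𝒜 i = nth (sortedDegrees 𝒜) (i ∸ 1)

bigN : ℕ → ℕ → ℕ → ℕ
bigN n k r = n C k ∸ ((n ∸ (r ∸ 1)) C k)

IsUnionOfStars : ∀ {n} → ℕ → ℕ → Family n → Set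
IsUnionOfStars {n} k r 𝒜 =
  Data.Product.Σ (Subset n) λ X → (∣ X ∣ ≡ r ∸ 1) Data.Product.×
    (∀ A → 𝒜 A ≡ (hasSize k A ∧ meets X A))
  where import Data.Product

InC : ∀ {n} → ℕ → ℕ → Family n → Set
InC {n} k r 𝒜 = IsKFamily k 𝒜 Data.Product.× (card 𝒜 ≡ bigN n k r)
  Data.Product.× (IsUnionOfStars k r 𝒜 → Data.Empty.⊥)
  where import Data.Product; import Data.Empty

-- 𝒜 ∈ 𝒞₁ : additionally |𝒜_{x_{r-1}}| < N / (2 r² k), i.e. 2 r² k |𝒜_{x_{r-1}}| < N.
InC₁ : ∀ {n} → ℕ → ℕ → Family n → Set
InC₁ {n} k r 𝒜 = InC k r 𝒜 Data.Product.× (2 * (r * r) * k * degreeAt 𝒜 (r ∸ 1) < bigN n k r)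
  where import Data.Product

module Submission where

-- Let High be the vertices of degree > D; there are at most r - 2 of them, since D is the
-- (r-1)-st largest degree.  The members of 𝒜 avoiding High form a list Low in which every
-- member meets at most kD members.  A greedy count shows that such a list with at least
-- r (q + kD + 1) entries contains q^r pairwise disjoint r-sets.  Since 𝒜 is as large as a union
-- of r-1 stars, while r-2 stars have at most (r-2) C(n-1,k-1) members, binomial estimates give
-- |Low| ≥ N / r; taking q = ⌊N / 4r²⌋ (where 2r²kD < N is used) yields N^r ≤ (8r²)^r |E|.

open import Defs
open import Data.Bool using (Bool; true; false; _∧_; _∨_; not; T)
open import Data.Bool.Properties using (_≟_; T-≡; ∧-conicalˡ; ∧-conicalʳ; ∧-zeroʳ; ∧-identityʳ)
open import Data.Nat using (ℕ; zero; suc; z<s; _⊔_; >-nonZero; ≢-nonZero; _+_; _*_; _∸_; _^_; _≤_; _<_; _<ᵇ_; z≤n; s≤s; NonZero)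
open import Data.Nat.Properties hiding (_≟_)
open import Data.Nat.Combinatorics using (_C_; nCk+nC[k+1]≡[n+1]C[k+1]; k>n⇒nCk≡0)
open import Data.Nat.DivMod using (_/_; _%_; m/n*n≤m; m≡m%n+[m/n]*n; m%n<n)
open import Data.Nat.Tactic.RingSolver using (solve-∀)
open import Data.List using (List; []; _∷_; map; length; filter; _++_; reverse; allFin)
import Data.List as List
import Data.List.Properties as ListP
open import Data.List.Membership.Propositional using (_∈_)
open import Data.List.Membership.Propositional.Properties using (∈-filter⁻)
open import Data.List.Relation.Unary.Any using (here; there)
open import Data.List.Relation.Unary.All as All using (All; []; _∷_)
import Data.List.Relation.Unary.All.Properties as AllP
open import Data.List.Relation.Unary.AllPairs using (AllPairs; []; _∷_)
import Data.List.Relation.Unary.AllPairs.Properties as AllPairsP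
open import Data.List.Relation.Unary.Linked.Properties using (Linked⇒AllPairs)
open import Data.List.Sort ≤-decTotalOrder using (sort; sort-↭; sort-↗)
open import Data.List.Relation.Binary.Permutation.Propositional using (_↭_)
open import Data.List.Relation.Binary.Permutation.Propositional.Properties using (↭-length; filter-↭; ↭-reverse)
open import Data.Fin using (Fin; zero; suc)
open import Data.Fin.Subset using (Subset; ∣_∣)
open import Data.Vec using (Vec; []; _∷_; lookup; tail; tabulate)
open import Data.Vec.Properties using (lookup∘tabulate)
open import Data.Product using (Σ; _×_; _,_; proj₁; proj₂)
open import Data.Sum using (_⊎_; inj₁; inj₂)
open import Data.Empty using (⊥; ⊥-elim)
open import Relation.Nullary using (yes; no)
open import Function.Bundles using (Equivalence)
open import Relation.Binary.PropositionalEquality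

count : {X : Set} → (X → Bool) → List X → ℕ
count f xs = length (filter (λ a → f a ≟ true) xs)

module _ {X : Set} where

  count-++ : (f : X → Bool) (xs ys : List X) → count f (xs ++ ys) ≡ count f xs + count f ys
  count-++ f xs ys = trans (cong length (ListP.filter-++ (λ a → f a ≟ true) xs ys))
                           (ListP.length-++ (filter (λ a → f a ≟ true) xs))

  count-reject : (f : X → Bool) (x : X) (xs : List X) → f x ≡ false → count f (x ∷ xs) ≡ count f xs
  count-reject f x xs fx≡false with f x
  count-reject f x xs refl | false = refl

  count-cons-≤ : (f : X → Bool) (x : X) (xs : List X) → count f xs ≤ count f (x ∷ xs)
  count-cons-≤ f x xs with f x
  ... | true = n≤1+n _
  ... | false = ≤-refl

  count-cons-≤-suc : (f : X → Bool) (x : X) (xs : List X) → count f (x ∷ xs) ≤ suc (count f xs)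
  count-cons-≤-suc f x xs with f x
  ... | true = ≤-refl
  ... | false = n≤1+n _

  count-mono-∈ : (f g : X → Bool) (xs : List X) →
    (∀ a → a ∈ xs → f a ≡ true → g a ≡ true) → count f xs ≤ count g xs
  count-mono-∈ f g [] f⇒g = z≤n
  count-mono-∈ f g (x ∷ xs) f⇒g with f x in fx | g x in gx
  ... | true  | true  = s≤s (count-mono-∈ f g xs (λ a a∈ → f⇒g a (there a∈)))
  ... | false | true  = m≤n⇒m≤1+n (count-mono-∈ f g xs (λ a a∈ → f⇒g a (there a∈)))
  ... | false | false = count-mono-∈ f g xs (λ a a∈ → f⇒g a (there a∈))
  ... | true  | false with () ← trans (sym gx) (f⇒g x (here refl) fx)

  count-mono : (f g : X → Bool) → (∀ a → f a ≡ true → g a ≡ true) → (xs : List X) → count f xs ≤ count g xs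
  count-mono f g f⇒g xs = count-mono-∈ f g xs (λ a _ → f⇒g a)

  count-ext : (f g : X → Bool) → (∀ a → f a ≡ g a) → (xs : List X) → count f xs ≡ count g xs
  count-ext f g f≗g xs = ≤-antisym (count-mono f g (λ a e → trans (sym (f≗g a)) e) xs)
                                   (count-mono g f (λ a e → trans (f≗g a) e) xs)

  count-none : (f : X → Bool) → (∀ a → f a ≡ false) → (xs : List X) → count f xs ≡ 0
  count-none f never [] = refl
  count-none f never (x ∷ xs) = trans (count-reject f x xs (never x)) (count-none f never xs)

  count-complement : (f : X → Bool) (xs : List X) → length xs ≡ count f xs + count (λ a → not (f a)) xs
  count-complement f [] = refl
  count-complement f (x ∷ xs) with f x
  ... | true = cong suc (count-complement f xs)
  ... | false = trans (cong suc (count-complement f xs)) (sym (+-suc _ _))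

  count-∨ : (f g : X → Bool) (xs : List X) → count (λ a → f a ∨ g a) xs ≤ count f xs + count g xs
  count-∨ f g [] = z≤n
  count-∨ f g (x ∷ xs) with f x | g x
  ... | true  | true  = s≤s (≤-trans (count-∨ f g xs) (+-monoʳ-≤ (count f xs) (n≤1+n _)))
  ... | true  | false = s≤s (count-∨ f g xs)
  ... | false | true  = ≤-trans (s≤s (count-∨ f g xs)) (≤-reflexive (sym (+-suc _ _)))
  ... | false | false = count-∨ f g xs

  count-filter : (g f : X → Bool) (xs : List X) →
    count f (filter (λ a → g a ≟ true) xs) ≡ count (λ a → g a ∧ f a) xs
  count-filter g f [] = refl
  count-filter g f (x ∷ xs) with g x
  ... | false = count-filter g f xs
  ... | true with f x
  ...   | true = cong suc (count-filter g f xs)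
  ...   | false = count-filter g f xs

  count-filter-≤ : (g f h : X → Bool) → (∀ a → g a ≡ true → f a ≡ true → h a ≡ true) → (xs : List X) →
    count f (filter (λ a → g a ≟ true) xs) ≤ count h xs
  count-filter-≤ g f h g∧f⇒h xs = ≤-trans (≤-reflexive (count-filter g f xs))
    (count-mono _ h (λ a e → g∧f⇒h a (∧-conicalˡ _ _ e) (∧-conicalʳ _ _ e)) xs)

count-map : {X Y : Set} (f : Y → Bool) (g : X → Y) (xs : List X) → count f (map g xs) ≡ count (λ a → f (g a)) xs
count-map f g [] = refl
count-map f g (x ∷ xs) with f (g x)
... | true = cong suc (count-map f g xs)
... | false = count-map f g xs

count-↭ : {X : Set} (f : X → Bool) {xs ys : List X} → xs ↭ ys → count f xs ≡ count f ys
count-↭ f xs↭ys = ↭-length (filter-↭ (λ a → f a ≟ true) xs↭ys)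

count-combinations-filter : {X : Set} (p : X → Bool) (Q Q' : List X → Bool) →
  (∀ e → All (λ a → p a ≡ true) e → Q' e ≡ true → Q e ≡ true) →
  ∀ r xs → count Q' (combinations r (filter (λ a → p a ≟ true) xs)) ≤ count Q (combinations r xs)
count-combinations-filter p Q Q' Q'⇒Q zero xs =
  count-mono-∈ Q' Q ([] ∷ []) (λ { a (here refl) → Q'⇒Q [] [] ; a (there ()) })
count-combinations-filter p Q Q' Q'⇒Q (suc r) [] = z≤n
count-combinations-filter p Q Q' Q'⇒Q (suc r) (y ∷ ys) with p y in py
... | true = begin
    count Q' (map (y ∷_) (combinations r F) ++ combinations (suc r) F)
      ≡⟨ count-++ Q' (map (y ∷_) (combinations r F)) _ ⟩
    count Q' (map (y ∷_) (combinations r F)) + count Q' (combinations (suc r) F)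
      ≡⟨ cong (_+ count Q' (combinations (suc r) F)) (count-map Q' (y ∷_) (combinations r F)) ⟩
    count (λ e → Q' (y ∷ e)) (combinations r F) + count Q' (combinations (suc r) F)
      ≤⟨ +-mono-≤ (count-combinations-filter p (λ e → Q (y ∷ e)) (λ e → Q' (y ∷ e))
                     (λ e all-p → Q'⇒Q (y ∷ e) (py ∷ all-p)) r ys)
                  (count-combinations-filter p Q Q' Q'⇒Q (suc r) ys) ⟩
    count (λ e → Q (y ∷ e)) (combinations r ys) + count Q (combinations (suc r) ys)
      ≡⟨ cong (_+ count Q (combinations (suc r) ys)) (sym (count-map Q (y ∷_) (combinations r ys))) ⟩
    count Q (map (y ∷_) (combinations r ys)) + count Q (combinations (suc r) ys)
      ≡⟨ sym (count-++ Q (map (y ∷_) (combinations r ys)) _) ⟩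
    count Q (map (y ∷_) (combinations r ys) ++ combinations (suc r) ys) ∎
  where
  open ≤-Reasoning
  F = filter (λ a → p a ≟ true) ys
... | false = ≤-trans (count-combinations-filter p Q Q' Q'⇒Q (suc r) ys)
  (≤-trans (m≤n+m _ _) (≤-reflexive (sym (count-++ Q (map (y ∷_) (combinations r ys)) _))))

∧-intro : ∀ {a b} → a ≡ true → b ≡ true → a ∧ b ≡ true
∧-intro refl refl = refl

pairwiseDisjoint-cons : ∀ {n} (x : Subset n) e → All (λ a → disjoint x a ≡ true) e →
  pairwiseDisjoint e ≡ true → pairwiseDisjoint (x ∷ e) ≡ true
pairwiseDisjoint-cons x [] [] _ = refl
pairwiseDisjoint-cons x (y ∷ e) (x∩y=∅ ∷ x∩e=∅) pd-ye =
  ∧-intro (∧-intro x∩y=∅ (∧-conicalˡ _ _ pd-xe)) pd-ye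
  where
  pd-xe : pairwiseDisjoint (x ∷ e) ≡ true
  pd-xe = pairwiseDisjoint-cons x e x∩e=∅ (∧-conicalʳ _ _ pd-ye)

edges : ∀ {n} → ℕ → List (Subset n) → ℕ
edges r L = count pairwiseDisjoint (combinations r L)

disjointFrom : ∀ {n} → Subset n → List (Subset n) → List (Subset n)
disjointFrom x L = filter (λ a → disjoint x a ≟ true) L

-- Every entry of L meets at most Δ entries of L (the maximum degree of the
-- intersection graph on L, counting the entry itself, is at most Δ).
ConflictBound : ∀ {n} → ℕ → List (Subset n) → Set
ConflictBound Δ L = ∀ A → A ∈ L → count (meets A) L ≤ Δ

conflictBound-tail : ∀ {n} Δ (x : Subset n) xs → ConflictBound Δ (x ∷ xs) → ConflictBound Δ xs
conflictBound-tail Δ x xs bound A A∈ = ≤-trans (count-cons-≤ (meets A) x xs) (bound A (there A∈))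

conflictBound-filter : ∀ {n} Δ (g : Subset n → Bool) xs → ConflictBound Δ xs →
  ConflictBound Δ (filter (λ a → g a ≟ true) xs)
conflictBound-filter Δ g xs bound A A∈ =
  ≤-trans (count-filter-≤ g (meets A) (meets A) (λ _ _ m → m) xs)
          (bound A (proj₁ (∈-filter⁻ (λ a → g a ≟ true) A∈)))

-- The (r+1)-edges of x ∷ xs either avoid x, or are x together with an r-edge among the
-- entries disjoint from x.
edges-cons : ∀ {n} r (x : Subset n) xs → edges r (disjointFrom x xs) + edges (suc r) xs ≤ edges (suc r) (x ∷ xs)
edges-cons r x xs = begin
  edges r (disjointFrom x xs) + edges (suc r) xs
    ≤⟨ +-monoˡ-≤ (edges (suc r) xs)
         (count-combinations-filter (disjoint x) (λ e → pairwiseDisjoint (x ∷ e)) pairwiseDisjoint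
            (pairwiseDisjoint-cons x) r xs) ⟩
  count (λ e → pairwiseDisjoint (x ∷ e)) (combinations r xs) + edges (suc r) xs
    ≡⟨ cong (_+ edges (suc r) xs) (sym (count-map pairwiseDisjoint (x ∷_) (combinations r xs))) ⟩
  count pairwiseDisjoint (map (x ∷_) (combinations r xs)) + edges (suc r) xs
    ≡⟨ sym (count-++ pairwiseDisjoint (map (x ∷_) (combinations r xs)) _) ⟩
  edges (suc r) (x ∷ xs) ∎
  where open ≤-Reasoning

disjointFrom-length : ∀ {n} Δ (x : Subset n) xs → ConflictBound Δ (x ∷ xs) →
  length xs ≤ length (disjointFrom x xs) + Δ
disjointFrom-length Δ x xs bound = begin
  length xs                                       ≡⟨ count-complement (disjoint x) xs ⟩
  length (disjointFrom x xs) + count (meets x) xs ≤⟨ +-monoʳ-≤ _ meets-x ⟩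
  length (disjointFrom x xs) + Δ                  ∎
  where
  open ≤-Reasoning
  meets-x : count (meets x) xs ≤ Δ
  meets-x = ≤-trans (count-cons-≤ (meets x) x xs) (bound x (here refl))

-- The companion
-- statement greedy-edges, proved simultaneously, is the induction along the list:
-- each of the first t entries x starts at least q^r disjoint (r+1)-sets through x.
edges-lower-bound : ∀ {n} q Δ r (L : List (Subset n)) → ConflictBound Δ L →
  r * (q + Δ + 1) ≤ length L → q ^ r ≤ edges r L
greedy-edges : ∀ {n} q Δ r t (L : List (Subset n)) → ConflictBound Δ L →
  t + r * (q + Δ + 1) + Δ + 1 ≤ length L → t * q ^ r ≤ edges (suc r) L

edges-lower-bound q Δ zero L bound long = ≤-refl
edges-lower-bound q Δ (suc r) L bound long =
  greedy-edges q Δ r q L bound (≤-trans (≤-reflexive (expand q Δ r)) long)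
  where
  expand : ∀ q Δ r → q + r * (q + Δ + 1) + Δ + 1 ≡ suc r * (q + Δ + 1)
  expand = solve-∀

greedy-edges q Δ r zero L bound long = z≤n
greedy-edges q Δ r (suc t) (x ∷ xs) bound (s≤s long) =
  ≤-trans (+-mono-≤ through-x avoiding-x) (edges-cons r x xs)
  where
  avoiding-x : t * q ^ r ≤ edges (suc r) xs
  avoiding-x = greedy-edges q Δ r t xs (conflictBound-tail Δ x xs bound) long
  shrink : ∀ t q Δ r l l' → t + r * (q + Δ + 1) + Δ + 1 ≤ l → l ≤ l' + Δ → r * (q + Δ + 1) ≤ l'
  shrink t q Δ r l l' l-big l≤l'+Δ = +-cancelʳ-≤ Δ _ _ (≤-trans (≤-trans (m≤m+n _ (t + 1))
    (≤-reflexive (rearrange t q Δ r))) (≤-trans l-big l≤l'+Δ))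
    where
    rearrange : ∀ t q Δ r → r * (q + Δ + 1) + Δ + (t + 1) ≡ t + r * (q + Δ + 1) + Δ + 1
    rearrange = solve-∀
  through-x : q ^ r ≤ edges r (disjointFrom x xs)
  through-x = edges-lower-bound q Δ r (disjointFrom x xs)
    (conflictBound-filter Δ (disjoint x) xs (conflictBound-tail Δ x xs bound))
    (shrink t q Δ r (length xs) _ long (disjointFrom-length Δ x xs bound))

weightSum : ∀ {n} → Subset n → (Fin n → ℕ) → ℕ
weightSum [] g = 0
weightSum (true ∷ S) g = g zero + weightSum S (λ x → g (suc x))
weightSum (false ∷ S) g = weightSum S (λ x → g (suc x))

weightSum-cong : ∀ {n} (S : Subset n) g h → (∀ x → g x ≡ h x) → weightSum S g ≡ weightSum S h
weightSum-cong [] g h g≗h = refl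
weightSum-cong (true ∷ S) g h g≗h = cong₂ _+_ (g≗h zero) (weightSum-cong S _ _ (λ x → g≗h (suc x)))
weightSum-cong (false ∷ S) g h g≗h = weightSum-cong S _ _ (λ x → g≗h (suc x))

weightSum-≤ : ∀ {n} (S : Subset n) g b → (∀ x → lookup S x ≡ true → g x ≤ b) → weightSum S g ≤ ∣ S ∣ * b
weightSum-≤ [] g b g≤b = z≤n
weightSum-≤ (true ∷ S) g b g≤b = +-mono-≤ (g≤b zero refl) (weightSum-≤ S _ b (λ x → g≤b (suc x)))
weightSum-≤ (false ∷ S) g b g≤b = weightSum-≤ S _ b (λ x → g≤b (suc x))

meets-cons : ∀ {n} s (S : Subset n) (A : Subset (suc n)) →
  meets (s ∷ S) A ≡ ((s ∧ lookup A zero) ∨ meets S (tail A))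
meets-cons true S (true ∷ A) = refl
meets-cons true S (false ∷ A) = refl
meets-cons false S (a ∷ A) = refl

count-meets-≤ : ∀ {n} (S : Subset n) (M : List (Subset n)) →
  count (meets S) M ≤ weightSum S (λ x → count (λ A → lookup A x) M)
count-meets-≤ [] M = ≤-reflexive (count-none (meets []) (λ { [] → refl }) M)
count-meets-≤ {suc n} (s ∷ S) M = begin
  count (meets (s ∷ S)) M
    ≡⟨ count-ext _ _ (meets-cons s S) M ⟩
  count (λ A → (s ∧ lookup A zero) ∨ meets S (tail A)) M
    ≤⟨ count-∨ (λ A → s ∧ lookup A zero) (λ A → meets S (tail A)) M ⟩
  count (λ A → s ∧ lookup A zero) M + count (λ A → meets S (tail A)) M
    ≤⟨ +-monoʳ-≤ _ rest ⟩
  count (λ A → s ∧ lookup A zero) M + weightSum S (λ x → count (λ A → lookup A (suc x)) M)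
    ≡⟨ first s ⟩
  weightSum (s ∷ S) (λ x → count (λ A → lookup A x) M) ∎
  where
  open ≤-Reasoning
  first : ∀ s → count (λ A → s ∧ lookup A zero) M + weightSum S (λ x → count (λ A → lookup A (suc x)) M)
                ≡ weightSum (s ∷ S) (λ x → count (λ A → lookup A x) M)
  first true = refl
  first false = cong (_+ weightSum S (λ x → count (λ A → lookup A (suc x)) M)) (count-none _ (λ _ → refl) M)
  lookup-tail : ∀ x (A : Subset (suc n)) → lookup (tail A) x ≡ lookup A (suc x)
  lookup-tail x (a ∷ A) = refl
  rest : count (λ A → meets S (tail A)) M ≤ weightSum S (λ x → count (λ A → lookup A (suc x)) M)
  rest = begin
    count (λ A → meets S (tail A)) M
      ≡⟨ sym (count-map (meets S) tail M) ⟩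
    count (meets S) (map tail M)
      ≤⟨ count-meets-≤ S (map tail M) ⟩
    weightSum S (λ x → count (λ A → lookup A x) (map tail M))
      ≡⟨ weightSum-cong S _ _ (λ x → trans (count-map _ tail M) (count-ext _ _ (lookup-tail x) M)) ⟩
    weightSum S (λ x → count (λ A → lookup A (suc x)) M) ∎

binom : ℕ → ℕ → ℕ
binom _ zero = 1
binom zero (suc k) = 0
binom (suc n) (suc k) = binom n k + binom n (suc k)

binom≡C : ∀ n k → binom n k ≡ n C k
binom≡C n zero = refl
binom≡C zero (suc k) = sym (k>n⇒nCk≡0 {0} {suc k} z<s)
binom≡C (suc n) (suc k) = trans (cong₂ _+_ (binom≡C n k) (binom≡C n (suc k))) (nCk+nC[k+1]≡[n+1]C[k+1] n k)

count-allSubsets-suc : ∀ n (f : Subset (suc n) → Bool) →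
  count f (allSubsets (suc n))
    ≡ count (λ A → f (true ∷ A)) (allSubsets n) + count (λ A → f (false ∷ A)) (allSubsets n)
count-allSubsets-suc n f = trans (count-++ f (map (true ∷_) (allSubsets n)) _)
  (cong₂ _+_ (count-map f (true ∷_) (allSubsets n)) (count-map f (false ∷_) (allSubsets n)))

count-hasSize : ∀ n k → count (hasSize k) (allSubsets n) ≡ binom n k
count-hasSize zero zero = refl
count-hasSize zero (suc k) = refl
count-hasSize (suc n) zero = trans (count-allSubsets-suc n (hasSize 0))
  (cong₂ _+_ (count-none _ (λ _ → refl) (allSubsets n)) (count-hasSize n 0))
count-hasSize (suc n) (suc k) = trans (count-allSubsets-suc n (hasSize (suc k)))
  (cong₂ _+_ (count-hasSize n k) (count-hasSize n (suc k)))

empty-avoids : ∀ {n} (A : Subset n) x → (hasSize 0 A ∧ lookup A x) ≡ false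
empty-avoids (true ∷ A) x = refl
empty-avoids (false ∷ A) zero = ∧-zeroʳ _
empty-avoids (false ∷ A) (suc x) = empty-avoids A x

count-star : ∀ n k (x : Fin (suc n)) → count (λ A → hasSize (suc k) A ∧ lookup A x) (allSubsets (suc n)) ≡ binom n k
count-star n k zero = trans (count-allSubsets-suc n _)
  (trans (cong₂ _+_ (count-ext _ _ (λ A → ∧-identityʳ _) (allSubsets n))
                    (count-none _ (λ A → ∧-zeroʳ _) (allSubsets n)))
         (trans (+-identityʳ _) (count-hasSize n k)))
count-star (suc n) zero (suc y) = trans (count-allSubsets-suc (suc n) _)
  (cong₂ _+_ (count-none _ (λ A → empty-avoids A y) (allSubsets (suc n))) (count-star n zero y))
count-star (suc n) (suc k) (suc y) = trans (count-allSubsets-suc (suc n) _)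
  (cong₂ _+_ (count-star n k y) (count-star n (suc k) y))

binom-suc : ∀ m j → binom m j ≤ binom (suc m) j
binom-suc m zero = ≤-refl
binom-suc m (suc j) = m≤n+m (binom m (suc j)) (binom m j)

binom-mono : ∀ t m j → binom m j ≤ binom (t + m) j
binom-mono zero m j = ≤-refl
binom-mono (suc t) m j = ≤-trans (binom-mono t m j) (binom-suc (t + m) j)

binom-1 : ∀ p → binom p 1 ≡ p
binom-1 zero = refl
binom-1 (suc p) = cong suc (binom-1 p)

binom-pos : ∀ p i → i ≤ p → 1 ≤ binom p i
binom-pos p zero _ = ≤-refl
binom-pos (suc p) (suc i) (s≤s i≤p) = ≤-trans (binom-pos p i i≤p) (m≤m+n _ _)

binom-absorb : ∀ p j → suc j * binom (suc p) (suc j) ≡ suc p * binom p j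
binom-absorb p zero = trans (*-identityˡ _) (trans (binom-1 (suc p)) (sym (*-identityʳ (suc p))))
binom-absorb zero (suc j) = *-zeroʳ (suc (suc j))
binom-absorb (suc p) (suc j) = pascal-step (binom-absorb p j) (binom-absorb p (suc j))
  where
  open ≡-Reasoning
  a = binom (suc p) (suc j)
  b = binom p j
  c = binom p (suc j)
  X = binom (suc p) (suc (suc j))
  pascal-step : (1 + j) * a ≡ (1 + p) * b → (2 + j) * X ≡ (1 + p) * c → (2 + j) * (a + X) ≡ (2 + p) * a
  pascal-step e₁ e₂ = begin
    (2 + j) * (a + X)             ≡⟨ expand j a X ⟩
    a + (1 + j) * a + (2 + j) * X ≡⟨ cong₂ (λ u v → a + u + v) e₁ e₂ ⟩
    a + (1 + p) * b + (1 + p) * c ≡⟨ collect p b c ⟩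
    (2 + p) * a                   ∎
    where
    expand : ∀ j a X → (2 + j) * (a + X) ≡ a + (1 + j) * a + (2 + j) * X
    expand = solve-∀
    collect : ∀ p b c → (b + c) + (1 + p) * b + (1 + p) * c ≡ (2 + p) * (b + c)
    collect = solve-∀

-- C(t+m,j) exceeds C(m,j) by at most a fraction t j / (m+1) of C(t+m,j):
-- (m+1) C(t+m,j) ≤ (m+1) C(m,j) + t j C(t+m,j), for j ≥ 1.
binom-growth : ∀ m j' t →
  suc m * binom (t + m) (suc j') ≤ suc m * binom m (suc j') + t * suc j' * binom (t + m) (suc j')
binom-growth m j' zero = m≤m+n _ _
binom-growth m j' (suc t) = begin
  suc m * (binom p j' + binom p j)     ≡⟨ *-distribˡ-+ (suc m) (binom p j') (binom p j) ⟩
  suc m * binom p j' + suc m * binom p j ≤⟨ +-mono-≤ absorbed (≤-trans (binom-growth m j' t) grown) ⟩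
  j * B' + (suc m * Bₘ + t * j * B')    ≡⟨ regroup (j * B') (suc m * Bₘ) (t * j * B') ⟩
  suc m * Bₘ + (j * B' + t * j * B')    ≡⟨ cong (suc m * Bₘ +_) (collect j t B') ⟩
  suc m * Bₘ + suc t * j * B'           ∎
  where
  open ≤-Reasoning
  j = suc j'
  p = t + m
  B' = binom (suc p) j
  Bₘ = binom m j
  absorbed : suc m * binom p j' ≤ j * B'
  absorbed = ≤-trans (*-monoˡ-≤ (binom p j') (s≤s (m≤n+m m t))) (≤-reflexive (sym (binom-absorb p j')))
  grown : suc m * Bₘ + t * j * binom p j ≤ suc m * Bₘ + t * j * B'
  grown = +-monoʳ-≤ (suc m * Bₘ) (*-monoʳ-≤ (t * j) (binom-suc p j))
  regroup : ∀ a b c → a + (b + c) ≡ b + (a + c)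
  regroup = solve-∀
  collect : ∀ j t B → j * B + t * j * B ≡ (1 + t) * j * B
  collect = solve-∀

-- Iterating Pascal's rule: C(t+m,j+1) ≥ C(m,j+1) + t C(m,j).
binom-shift-lower : ∀ t m j → binom m (suc j) + t * binom m j ≤ binom (t + m) (suc j)
binom-shift-lower zero m j = ≤-reflexive (+-identityʳ _)
binom-shift-lower (suc t) m j = begin
  binom m (suc j) + (binom m j + t * binom m j) ≡⟨ regroup (binom m (suc j)) (binom m j) (t * binom m j) ⟩
  binom m j + (binom m (suc j) + t * binom m j) ≤⟨ +-mono-≤ (binom-mono t m j) (binom-shift-lower t m j) ⟩
  binom (t + m) j + binom (t + m) (suc j)       ∎
  where
  open ≤-Reasoning
  regroup : ∀ a b c → a + (b + c) ≡ b + (a + c)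
  regroup = solve-∀

binom-linear : ∀ j' t → t + 1 ≤ binom (t + suc j') (suc j')
binom-linear j' zero = binom-pos (suc j') (suc j') ≤-refl
binom-linear j' (suc t) = begin
  suc t + 1                                           ≤⟨ +-mono-≤ (binom-pos (t + suc j') j' j'≤) (binom-linear j' t) ⟩
  binom (t + suc j') j' + binom (t + suc j') (suc j') ∎
  where
  open ≤-Reasoning
  j'≤ : j' ≤ t + suc j'
  j'≤ = ≤-trans (n≤1+n j') (m≤n+m _ t)

∣tabulate∣≡count : ∀ {n} {X : Set} (h : X → Bool) (g : Fin n → X) → ∣ tabulate (λ x → h (g x)) ∣ ≡ count h (List.tabulate g)
∣tabulate∣≡count {zero} h g = refl
∣tabulate∣≡count {suc n} h g with h (g zero)
... | true = cong suc (∣tabulate∣≡count h (λ x → g (suc x)))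
... | false = ∣tabulate∣≡count h (λ x → g (suc x))

All-reverse : {X : Set} {P : X → Set} (xs : List X) → All P xs → All P (reverse xs)
All-reverse [] [] = []
All-reverse (x ∷ xs) (px ∷ pxs) rewrite ListP.unfold-reverse x xs = AllP.++⁺ (All-reverse xs pxs) (px ∷ [])

ascending-reverse : (xs : List ℕ) → AllPairs _≤_ xs → AllPairs (λ a b → b ≤ a) (reverse xs)
ascending-reverse [] [] = []
ascending-reverse (x ∷ xs) (x≤xs ∷ xs↗) rewrite ListP.unfold-reverse x xs =
  AllPairsP.++⁺ (ascending-reverse xs xs↗) ([] ∷ []) (All.map (λ x≤y → x≤y ∷ []) (All-reverse xs x≤xs))

descending-above-nth : ∀ (R : List ℕ) i → AllPairs (λ a b → b ≤ a) R → count (λ y → nth R i <ᵇ y) R ≤ i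
descending-above-nth [] i _ = z≤n
descending-above-nth (x ∷ R) zero (x≥R ∷ _) =
  ≤-reflexive (trans (count-reject _ x R (not-above x ≤-refl)) (count-none-above R x≥R))
  where
  not-above : ∀ b → b ≤ x → (x <ᵇ b) ≡ false
  not-above b b≤x with x <ᵇ b in e
  ... | false = refl
  ... | true = ⊥-elim (<⇒≱ (<ᵇ⇒< x b (subst T (sym e) _)) b≤x)
  count-none-above : ∀ R → All (λ b → b ≤ x) R → count (λ y → x <ᵇ y) R ≡ 0
  count-none-above [] [] = refl
  count-none-above (b ∷ R) (b≤x ∷ R≤x) = trans (count-reject _ b R (not-above b b≤x)) (count-none-above R R≤x)
descending-above-nth (x ∷ R) (suc i) (_ ∷ R↘) =
  ≤-trans (count-cons-≤-suc (λ y → nth R i <ᵇ y) x R) (s≤s (descending-above-nth R i R↘))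

above-sorted-degree : ∀ {n} (deg : Fin n → ℕ) i →
  ∣ tabulate (λ x → nth (reverse (sort (map deg (allFin n)))) i <ᵇ deg x) ∣ ≤ i
above-sorted-degree {n} deg i = begin
  ∣ tabulate (λ x → above (deg x)) ∣ ≡⟨ ∣tabulate∣≡count above deg ⟩
  count above (List.tabulate deg)   ≡⟨ cong (count above) (sym (ListP.map-tabulate (λ x → x) deg)) ⟩
  count above ds                    ≡⟨ sym (count-↭ above (sort-↭ ds)) ⟩
  count above (sort ds)             ≡⟨ sym (count-↭ above (↭-reverse (sort ds))) ⟩
  count above (reverse (sort ds))   ≤⟨ descending-above-nth (reverse (sort ds)) i sorted ⟩
  i                                 ∎
  where
  open ≤-Reasoning
  ds = map deg (allFin n)
  above = λ y → nth (reverse (sort ds)) i <ᵇ y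
  sorted : AllPairs (λ a b → b ≤ a) (reverse (sort ds))
  sorted = ascending-reverse (sort ds) (Linked⇒AllPairs ≤-trans (sort-↗ ds))

fraction-bound : ∀ a c m P E → suc m * E ≤ c * (P + E) → a * c ≤ suc m → a * E ≤ P + E
fraction-bound a c m P zero _ _ = subst (_≤ P + 0) (sym (*-zeroʳ a)) z≤n
fraction-bound a zero m P (suc e) () _
fraction-bound a c@(suc _) m P E@(suc _) growth ac≤m+1 = *-cancelˡ-≤ c (begin
  c * (a * E) ≡⟨ reassoc c a E ⟩
  (a * c) * E ≤⟨ *-monoˡ-≤ E ac≤m+1 ⟩
  suc m * E   ≤⟨ growth ⟩
  c * (P + E) ∎)
  where
  open ≤-Reasoning
  reassoc : ∀ c a E → c * (a * E) ≡ (a * c) * E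
  reassoc = solve-∀

-- Writing B = P + E: if (m+1) B ≤ (m+1) P + c B and (s+1)² c ≤ m + 1, then (s+1)² E ≤ B.
-- (B will be the maximum degree C(n-1,k-1) and P the binomial C(m,k-1) of a smaller ground set.)
small-excess : ∀ s c m P E → suc m * (P + E) ≤ suc m * P + c * (P + E) → suc s * suc s * c ≤ suc m →
  suc s * suc s * E ≤ P + E
small-excess s c m P E growth bound = fraction-bound (suc s * suc s) c m P E excess bound
  where
  excess : suc m * E ≤ c * (P + E)
  excess = +-cancelˡ-≤ (suc m * P) _ _
    (≤-trans (≤-reflexive (sym (*-distribˡ-+ (suc m) P E))) growth)

-- Counting argument for the family: if N ≤ L + s (P + E) (all but L members meet one of
-- s stars of size ≤ P + E), N ≥ (s+1) P and (s+1)² E ≤ P + E, then N ≤ (s+2) L.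
most-members-remain : ∀ s P E N L → N ≤ L + s * (P + E) → suc s * P ≤ N → suc s * suc s * E ≤ P + E →
  N ≤ (2 + s) * L
most-members-remain s P E N L N≤ N≥ E-small = +-cancelʳ-≤ X N ((2 + s) * L) (begin
  N + X                  ≤⟨ +-monoʳ-≤ N X≤ ⟩
  N + suc s * N          ≡⟨ collect s N ⟩
  (2 + s) * N            ≤⟨ *-monoʳ-≤ (2 + s) N≤ ⟩
  (2 + s) * (L + s * B)  ≡⟨ *-distribˡ-+ (2 + s) L (s * B) ⟩
  (2 + s) * L + X        ∎)
  where
  open ≤-Reasoning
  B = P + E
  X = (2 + s) * (s * B)
  expand : ∀ s P E → (2 + s) * (s * (P + E)) + (P + E) ≡ suc s * suc s * P + suc s * suc s * E
  expand = solve-∀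
  collect : ∀ s N → N + suc s * N ≡ (2 + s) * N
  collect = solve-∀
  X≤ : X ≤ suc s * N
  X≤ = +-cancelʳ-≤ B X (suc s * N) (begin
    X + B                                 ≡⟨ expand s P E ⟩
    suc s * suc s * P + suc s * suc s * E ≤⟨ +-monoʳ-≤ (suc s * suc s * P) E-small ⟩
    suc s * suc s * P + B                 ≤⟨ +-monoˡ-≤ B (≤-trans (≤-reflexive (*-assoc (suc s) (suc s) P))
                                                                  (*-monoʳ-≤ (suc s) N≥)) ⟩
    suc s * N + B                         ∎)

quotient-bounds : ∀ N d .{{_ : NonZero d}} → N / d * d ≤ N × N < suc (N / d) * d
quotient-bounds N d = m/n*n≤m N d , subst (_< suc (N / d) * d) (sym (m≡m%n+[m/n]*n N d))
  (+-monoˡ-< (N / d * d) (m%n<n N d))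

below-double : ∀ N d q → d ≤ N → N < suc q * d → N ≤ 2 * d * q
below-double N d zero d≤N N<d = ⊥-elim (<⇒≱ (subst (N <_) (+-identityʳ d) N<d) d≤N)
below-double N d (suc q) d≤N N< = ≤-trans (<⇒≤ N<) (subst (suc (suc q) * d ≤_) (collect d q) (m≤m+n _ _))
  where
  collect : ∀ d q → suc (suc q) * d + q * d ≡ 2 * d * suc q
  collect = solve-∀

*-^-distrib : ∀ a b r → (a * b) ^ r ≡ a ^ r * b ^ r
*-^-distrib a b zero = refl
*-^-distrib a b (suc r) = trans (cong ((a * b) *_) (*-^-distrib a b r)) (regroup a b (a ^ r) (b ^ r))
  where
  regroup : ∀ a b x y → a * b * (x * y) ≡ a * x * (b * y)
  regroup = solve-∀

-- Choosing q = ⌊N / 4r²⌋ in a greedy bound "r (q + Δ + 1) ≤ L implies q^r ≤ E" gives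
-- N^r ≤ (8r²)^r E, as soon as N ≤ r L, 2 r² Δ < N and 4 r² ≤ N.
power-from-greedy : ∀ r' Δ N L E → let r = suc r' in
  N ≤ r * L → 2 * (r * r) * Δ < N → 4 * (r * r) ≤ N →
  (∀ q → r * (q + Δ + 1) ≤ L → q ^ r ≤ E) → N ^ r ≤ (8 * (r * r)) ^ r * E
power-from-greedy r' Δ N L E N≤rL Δ-small N-large greedy = begin
  N ^ r                  ≤⟨ ^-monoˡ-≤ r N≤ ⟩
  (8 * (r * r) * q) ^ r  ≡⟨ *-^-distrib (8 * (r * r)) q r ⟩
  (8 * (r * r)) ^ r * q ^ r ≤⟨ *-monoʳ-≤ ((8 * (r * r)) ^ r) (greedy q fits) ⟩
  (8 * (r * r)) ^ r * E  ∎
  where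
  open ≤-Reasoning
  r = suc r'
  d = 4 * (r * r)
  q = N / d
  bounds = quotient-bounds N d
  N≤ : N ≤ 8 * (r * r) * q
  N≤ = subst (N ≤_) (cong (_* q) (sym (*-assoc 2 4 (r * r)))) (below-double N d q N-large (proj₂ bounds))
  expand : ∀ R q Δ → 4 * (R * (q + Δ + 1)) ≡ q * (4 * R) + 2 * (2 * R * Δ) + 4 * R
  expand = solve-∀
  four-N : ∀ N → N + 2 * N + N ≡ 4 * N
  four-N = solve-∀
  rr-fits : r * r * (q + Δ + 1) ≤ N
  rr-fits = *-cancelˡ-≤ 4 (begin
    4 * (r * r * (q + Δ + 1))           ≡⟨ expand (r * r) q Δ ⟩
    q * d + 2 * (2 * (r * r) * Δ) + d   ≤⟨ +-mono-≤ (+-mono-≤ (proj₁ bounds) (*-monoʳ-≤ 2 (<⇒≤ Δ-small))) N-large ⟩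
    N + 2 * N + N                       ≡⟨ four-N N ⟩
    4 * N                               ∎)
  fits : r * (q + Δ + 1) ≤ L
  fits = *-cancelˡ-≤ r (≤-trans (≤-reflexive (sym (*-assoc r r (q + Δ + 1)))) (≤-trans rr-fits N≤rL))

∈-members : ∀ {n} (𝒜 : Family n) A → A ∈ members 𝒜 → 𝒜 A ≡ true
∈-members {n} 𝒜 A A∈ = proj₂ (∈-filter⁻ (λ A → 𝒜 A ≟ true) {xs = allSubsets n} A∈)

disjoint-lookup : ∀ {n} (S A : Subset n) x → disjoint S A ≡ true → lookup A x ≡ true → lookup S x ≡ false
disjoint-lookup (true ∷ S) (true ∷ A) x () _
disjoint-lookup (false ∷ S) (a ∷ A) zero _ _ = refl
disjoint-lookup (true ∷ S) (false ∷ A) zero _ ()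
disjoint-lookup (false ∷ S) (a ∷ A) (suc x) S∩A=∅ x∈A = disjoint-lookup S A x S∩A=∅ x∈A
disjoint-lookup (true ∷ S) (false ∷ A) (suc x) S∩A=∅ x∈A = disjoint-lookup S A x S∩A=∅ x∈A

degree-≤-binom : ∀ n' j (𝒜 : Family (suc n')) → IsKFamily (suc j) 𝒜 → ∀ x → degree 𝒜 x ≤ binom n' j
degree-≤-binom n' j 𝒜 𝒜-uniform x = ≤-trans
  (count-filter-≤ 𝒜 (λ A → lookup A x) (λ A → hasSize (suc j) A ∧ lookup A x)
    (λ A A∈𝒜 x∈A → ∧-intro (Equivalence.to T-≡ (≡⇒≡ᵇ ∣ A ∣ (suc j) (𝒜-uniform A A∈𝒜))) x∈A)
    (allSubsets (suc n')))
  (≤-reflexive (count-star n' j x))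

-- The structure of a family 𝒜 of k-sets, k = j + 1, with r = s + 2.  The vertices of degree
-- above D = |𝒜_{x_{r-1}}| form a set High of at most s vertices; the members of 𝒜 avoiding
-- High (the list Low) make up all of 𝒜 but at most s full stars, and inside Low every member
-- meets at most k D others, so the greedy bound applies to Low.
module FamilyStructure (s n' j : ℕ) (𝒜 : Family (suc n')) (𝒜-uniform : IsKFamily (suc j) 𝒜) where

  r k D : ℕ
  r = suc (suc s)
  k = suc j
  D = degreeAt 𝒜 (r ∸ 1)

  High : Subset (suc n')
  High = tabulate (λ x → D <ᵇ degree 𝒜 x)

  Low : List (Subset (suc n'))
  Low = disjointFrom High (members 𝒜)

  few-high : ∣ High ∣ ≤ s
  few-high = above-sorted-degree (degree 𝒜) s

  card-≤-low : card 𝒜 ≤ length Low + s * binom n' j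
  card-≤-low = begin
    length (members 𝒜)                                  ≡⟨ count-complement (disjoint High) (members 𝒜) ⟩
    length Low + count (meets High) (members 𝒜)         ≤⟨ +-monoʳ-≤ (length Low) (count-meets-≤ High (members 𝒜)) ⟩
    length Low + weightSum High (degree 𝒜)              ≤⟨ +-monoʳ-≤ (length Low)
                                                             (weightSum-≤ High (degree 𝒜) (binom n' j)
                                                                (λ x _ → degree-≤-binom n' j 𝒜 𝒜-uniform x)) ⟩
    length Low + ∣ High ∣ * binom n' j                  ≤⟨ +-monoʳ-≤ (length Low) (*-monoˡ-≤ (binom n' j) few-high) ⟩
    length Low + s * binom n' j                         ∎
    where open ≤-Reasoning

  low-degree : ∀ A x → disjoint High A ≡ true → lookup A x ≡ true → degree 𝒜 x ≤ D
  low-degree A x High∩A=∅ x∈A = ≮⇒≥ λ D<deg → not-high (<⇒<ᵇ D<deg)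
    where
    not-high : T (D <ᵇ degree 𝒜 x) → ⊥
    not-high = subst T (trans (sym (lookup∘tabulate (λ x → D <ᵇ degree 𝒜 x) x))
                              (disjoint-lookup High A x High∩A=∅ x∈A))

  low-conflict : ConflictBound (k * D) Low
  low-conflict A A∈Low = begin
    count (meets A) Low            ≤⟨ count-filter-≤ (disjoint High) (meets A) (meets A) (λ _ _ m → m) (members 𝒜) ⟩
    count (meets A) (members 𝒜)    ≤⟨ count-meets-≤ A (members 𝒜) ⟩
    weightSum A (degree 𝒜)         ≤⟨ weightSum-≤ A (degree 𝒜) D (λ x → low-degree A x (proj₂ A∈)) ⟩
    ∣ A ∣ * D                      ≡⟨ cong (_* D) (𝒜-uniform A (∈-members 𝒜 A (proj₁ A∈))) ⟩
    k * D                          ∎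
    where
    open ≤-Reasoning
    A∈ = ∈-filter⁻ (λ A → disjoint High A ≟ true) {xs = members 𝒜} A∈Low

  edges-from-low : ∀ q → r * (q + k * D + 1) ≤ length Low → q ^ r ≤ numEdges r 𝒜
  edges-from-low q long = ≤-trans (edges-lower-bound q (k * D) r Low low-conflict long)
    (count-combinations-filter (disjoint High) pairwiseDisjoint pairwiseDisjoint (λ _ _ pd → pd) r (members 𝒜))

-- The edge bound for n = m + s + 1 with m = t + k - 1, under the size conditions
-- (s+1)² s (k-1) ≤ m + 1 and 4 r² ≤ t + 1.  Here N = C(n,k) - C(m,k) ≥ (s+1) C(m,k-1),
-- the maximum degree C(n-1,k-1) is close to C(m,k-1), so Low carries at least N / r members
-- and the greedy bound applies to it.
family-bound : ∀ s j' t → let m = t + suc j' ; n = suc (s + m) ; k = suc (suc j') ; r = suc (suc s) in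
  (𝒜 : Family n) → InC₁ k r 𝒜 → suc s * suc s * (s * suc j') ≤ suc m → 4 * (r * r) ≤ t + 1 →
  bigN n k r ^ r ≤ (8 * (r * r)) ^ r * numEdges r 𝒜
family-bound s j' t 𝒜 ((𝒜-uniform , card≡N , _) , D-small) m-large t-large =
  power-from-greedy (suc s) (k * D) N (length Low) (numEdges r 𝒜) N≤rLow Δ-small N-large edges-from-low
  where
  m = t + suc j'
  open FamilyStructure s (s + m) (suc j') 𝒜 𝒜-uniform
  n = suc (s + m)
  N = bigN n k r
  Cₘ = binom m (suc j')
  E = binom (s + m) (suc j') ∸ Cₘ
  B≡ : binom (s + m) (suc j') ≡ Cₘ + E
  B≡ = sym (m+[n∸m]≡n (binom-mono s m (suc j')))
  N≡ : N ≡ binom n k ∸ binom m k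
  N≡ = trans (cong (λ x → n C k ∸ x C k) (m+n∸m≡n s m)) (sym (cong₂ _∸_ (binom≡C n k) (binom≡C m k)))
  N≥ : suc s * Cₘ ≤ N
  N≥ = subst (suc s * Cₘ ≤_) (sym N≡) (m+n≤o⇒m≤o∸n (suc s * Cₘ)
         (subst (_≤ binom n k) (+-comm (binom m k) (suc s * Cₘ)) (binom-shift-lower (suc s) m (suc j'))))
  N≤ : N ≤ length Low + s * (Cₘ + E)
  N≤ = subst₂ (λ a b → a ≤ length Low + s * b) card≡N B≡ card-≤-low
  E-small : suc s * suc s * E ≤ Cₘ + E
  E-small = small-excess s (s * suc j') m Cₘ E
    (subst (λ b → suc m * b ≤ suc m * Cₘ + s * suc j' * b) B≡ (binom-growth m j' s)) m-large
  N≤rLow : N ≤ r * length Low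
  N≤rLow = most-members-remain s Cₘ E N (length Low) N≤ N≥ E-small
  Δ-small : 2 * (r * r) * (k * D) < N
  Δ-small = subst (_< N) (*-assoc (2 * (r * r)) k D) D-small
  N-large : 4 * (r * r) ≤ N
  N-large = ≤-trans t-large (≤-trans (binom-linear j' t) (≤-trans (m≤m+n Cₘ (s * Cₘ)) N≥))

cube-bound : ∀ s j' → let r = suc (suc s) in suc s * suc s * (s * suc j') + s ≤ r * r * r * suc (suc j')
cube-bound s j' = begin
  suc s * suc s * (s * suc j') + s   ≡⟨ reassoc s j' ⟩
  suc s * suc s * s * suc j' + s     ≤⟨ +-mono-≤ (*-monoˡ-≤ (suc j') cube) s≤r³ ⟩
  r * r * r * suc j' + r * r * r     ≡⟨ collect (r * r * r) j' ⟩
  r * r * r * suc (suc j')           ∎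
  where
  open ≤-Reasoning
  r = suc (suc s)
  reassoc : ∀ s j' → suc s * suc s * (s * suc j') + s ≡ suc s * suc s * s * suc j' + s
  reassoc = solve-∀
  collect : ∀ R j' → R * suc j' + R ≡ R * suc (suc j')
  collect = solve-∀
  s≤r : s ≤ r
  s≤r = ≤-trans (n≤1+n s) (n≤1+n (suc s))
  cube : suc s * suc s * s ≤ r * r * r
  cube = *-mono-≤ (*-mono-≤ (n≤1+n (suc s)) (n≤1+n (suc s))) s≤r
  s≤r³ : s ≤ r * r * r
  s≤r³ = ≤-trans s≤r (m≤n*m r (r * r))

-- Under r³ k ≤ n and 2 (r + 4 r²) ≤ n, n has the shape n = s + m + 1, m = t + k - 1, required by
-- family-bound, with both of its size conditions.
size-split : ∀ s j' n → let r = suc (suc s) ; k = suc (suc j') in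
  r * r * r * k ≤ n → 2 * (r + 4 * (r * r)) ≤ n →
  Σ ℕ λ t → n ≡ suc (s + (t + suc j'))
          × suc s * suc s * (s * suc j') ≤ suc (t + suc j')
          × 4 * (r * r) ≤ t + 1
size-split s j' n cube-small n-large = t , n≡ , m-large , t-large
  where
  r = suc (suc s)
  k = suc (suc j')
  a = suc s + suc j'
  doubled : ∀ r k R → 2 * (k + r + R) ≡ 2 * k + 2 * (r + R)
  doubled = solve-∀
  twice : ∀ n → n + n ≡ 2 * n
  twice = solve-∀
  2k≤n : 2 * k ≤ n
  2k≤n = ≤-trans (*-monoˡ-≤ k (≤-trans (s≤s (s≤s z≤n)) (m≤n*m r (r * r)))) cube-small
  k+r+4r²≤n : k + r + 4 * (r * r) ≤ n
  k+r+4r²≤n = *-cancelˡ-≤ 2 (≤-trans (≤-reflexive (doubled r k (4 * (r * r))))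
                                     (≤-trans (+-mono-≤ 2k≤n n-large) (≤-reflexive (twice n))))
  shift : ∀ s j' R → suc (suc j') + suc (suc s) + R ≡ (suc s + suc j') + (R + 2)
  shift = solve-∀
  a+4r²+2≤n : a + (4 * (r * r) + 2) ≤ n
  a+4r²+2≤n = ≤-trans (≤-reflexive (sym (shift s j' (4 * (r * r))))) k+r+4r²≤n
  t = n ∸ a
  a+t≡n : a + t ≡ n
  a+t≡n = m+[n∸m]≡n (≤-trans (m≤m+n a _) a+4r²+2≤n)
  reorder : ∀ s j' t → suc s + suc j' + t ≡ suc (s + (t + suc j'))
  reorder = solve-∀
  n≡ : n ≡ suc (s + (t + suc j'))
  n≡ = trans (sym a+t≡n) (reorder s j' t)
  t-large : 4 * (r * r) ≤ t + 1
  t-large = ≤-trans (m≤m+n _ 2)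
    (≤-trans (+-cancelˡ-≤ a _ _ (≤-trans a+4r²+2≤n (≤-reflexive (sym a+t≡n)))) (m≤m+n t 1))
  swap : ∀ s X → suc (s + X) ≡ suc X + s
  swap = solve-∀
  m-large : suc s * suc s * (s * suc j') ≤ suc (t + suc j')
  m-large = +-cancelʳ-≤ s _ _
    (≤-trans (cube-bound s j') (≤-trans cube-small (≤-reflexive (trans n≡ (swap s (t + suc j'))))))

main-bound : ∀ s n k → let r = suc (suc s) in
  2 ≤ k → r * r * r * k ≤ n → 2 * (r + 4 * (r * r)) ≤ n →
  (𝒜 : Family n) → InC₁ k r 𝒜 → bigN n k r ^ r ≤ (8 * (r * r)) ^ r * numEdges r 𝒜
main-bound s n (suc (suc j')) (s≤s (s≤s z≤n)) cube-small n-large =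
  let (t , n≡ , m-large , t-large) = size-split s j' n cube-small n-large
  in subst (λ n → (𝒜 : Family n) → InC₁ k r 𝒜 → bigN n k r ^ r ≤ (8 * (r * r)) ^ r * numEdges r 𝒜)
           (sym n≡) (λ 𝒜 𝒜∈ → family-bound s j' t 𝒜 𝒜∈ m-large t-large)
  where
  r = suc (suc s)
  k = suc (suc j')

K≤K^suc : ∀ K m → 1 ≤ K → K ≤ K ^ suc m
K≤K^suc (suc K) m _ = m≤m*n (suc K) (suc K ^ m) {{>-nonZero (m^n>0 (suc K) m)}}

-- If K^7 ≤ c n and n ≥ M² c, then M K ≤ n (otherwise K^6 < c M, so K < c M and n < M K < M² c).
seventh-power-small : ∀ M c K n → 1 ≤ K → K ^ 7 ≤ c * n → M * (c * M) ≤ n → M * K ≤ n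
seventh-power-small M c K n 1≤K K⁷≤cn M²c≤n with M * K ≤? n
... | yes MK≤n = MK≤n
... | no MK≰n = ⊥-elim (<-irrefl refl (≤-<-trans M²c≤n n<M²c))
  where
  n<MK : n < M * K
  n<MK = ≰⇒> MK≰n
  instance
    c≢0 : NonZero c
    c≢0 = ≢-nonZero λ { refl → <⇒≱ (≤-trans (s≤s z≤n) (^-monoˡ-≤ 7 1≤K)) K⁷≤cn }
  reorder : ∀ c M K → c * (M * K) ≡ K * (c * M)
  reorder = solve-∀
  K⁷<KcM : K * K ^ 6 < K * (c * M)
  K⁷<KcM = ≤-<-trans K⁷≤cn (subst (c * n <_) (reorder c M K) (*-monoʳ-< c n<MK))
  K<cM : K < c * M
  K<cM = ≤-<-trans (K≤K^suc K 5 1≤K) (*-cancelˡ-< K (K ^ 6) (c * M) K⁷<KcM)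
  n<M²c : n < M * (c * M)
  n<M²c = <-≤-trans n<MK (*-monoʳ-≤ M (<⇒≤ K<cM))

eventually-large : ∀ r (k : ℕ → ℕ) →
  ((Σ ℕ λ c → Σ ℕ λ n₁ → (n : ℕ) → n₁ ≤ n → 2 ≤ k n × k n ^ 7 ≤ c * n)
    ⊎ ((r ≡ 2 ⊎ r ≡ 3)
        × (Σ ℕ λ n₁ → (n : ℕ) → n₁ ≤ n → 2 ≤ k n)
        × ((m : ℕ) → Σ ℕ λ n₁ → (n : ℕ) → n₁ ≤ n → m * k n ^ 3 ≤ n))) →
  Σ ℕ λ n₀ → (n : ℕ) → n₀ ≤ n → 2 ≤ k n × r * r * r * k n ≤ n × 2 * (r + 4 * (r * r)) ≤ n
eventually-large r k (inj₁ (c , n₁ , k-small)) = n₁ ⊔ R³ * (c * R³) ⊔ Z , λ n n₀≤n →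
  let (2≤k , k⁷≤cn) = k-small n (≤-trans (≤-trans (m≤m⊔n n₁ _) (m≤m⊔n _ Z)) n₀≤n)
  in 2≤k , seventh-power-small R³ c (k n) n (≤-trans (s≤s z≤n) 2≤k) k⁷≤cn
             (≤-trans (≤-trans (m≤n⊔m n₁ _) (m≤m⊔n _ Z)) n₀≤n)
         , ≤-trans (m≤n⊔m _ Z) n₀≤n
  where
  R³ = r * r * r
  Z = 2 * (r + 4 * (r * r))
eventually-large r k (inj₂ (_ , (n₁ , 2≤k) , k³-small)) = n₁ ⊔ proj₁ (k³-small R³) ⊔ Z , λ n n₀≤n →
  let 2≤kn = 2≤k n (≤-trans (≤-trans (m≤m⊔n n₁ _) (m≤m⊔n _ Z)) n₀≤n)
  in 2≤kn , ≤-trans (*-monoʳ-≤ R³ (K≤K^suc (k n) 2 (≤-trans (s≤s z≤n) 2≤kn)))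
                    (proj₂ (k³-small R³) n (≤-trans (≤-trans (m≤n⊔m n₁ _) (m≤m⊔n _ Z)) n₀≤n))
          , ≤-trans (m≤n⊔m _ Z) n₀≤n
  where
  R³ = r * r * r
  Z = 2 * (r + 4 * (r * r))

-- Lemma 1 with η₁ = (8 r²)^{-r}: for r ≥ 2 and all large n, every 𝒜 ∈ 𝒞₁ satisfies
-- N^r ≤ (8 r²)^r |E(KG^r_{n,k}[𝒜])|.
lemma1 : (r : ℕ) → 2 ≤ r →
    Σ ℕ λ d → 1 ≤ d ×
    ((k : ℕ → ℕ) →
    ((Σ ℕ λ C → Σ ℕ λ n₁ → (n : ℕ) → n₁ ≤ n → 2 ≤ k n × k n ^ 7 ≤ C * n)
    ⊎ ((r ≡ 2 ⊎ r ≡ 3)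
    × (Σ ℕ λ n₁ → (n : ℕ) → n₁ ≤ n → 2 ≤ k n)
    × ((m : ℕ) → Σ ℕ λ n₁ → (n : ℕ) → n₁ ≤ n → m * k n ^ 3 ≤ n))) →
    Σ ℕ λ n₀ → (n : ℕ) → n₀ ≤ n → r * (2 * k n + 1) ≤ 2 * n →
    (𝒜 : Family n) → InC₁ (k n) r 𝒜 →
    bigN n (k n) r ^ r ≤ d * numEdges r 𝒜)
lemma1 r@(suc (suc s)) (s≤s (s≤s z≤n)) = (8 * (r * r)) ^ r , m^n>0 (8 * (r * r)) r , λ k k-growth →
  let (n₀ , large) = eventually-large r k k-growth
  in n₀ , λ n n₀≤n _ → let (2≤k , r³k≤n , n-large) = large n n₀≤n
                       in main-bound s n (k n) 2≤k r³k≤n n-large
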